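{- Let $f,l$ be positive integers with $l$ even, $N=l^f$, and consider $\pm1$ variables $S_i$ indexed by $i=(x_1,\dots,x_f)\in\{1,\dots,l\}^f$, with the Hamiltonian $$H=\sum_{\text{columns } C}\Bigl(\sum_{i\in C}S_i-M_C\Bigr)^2$$ for some integers $M_C$. If the choice of the $M_C$ is such that there is at least one zero energy assignment, then every global minimum of $H$ is a $(2^f-1)$-minimum.
   Context: A column $C$ is specified by an integer $b$ with $1\le b\le f$ together with integers $y_a\in\{1,\dots,l\}$ for all $a\neq b$; a variable $(x_1,\dots,x_f)$ lies in $C$ if $x_a=y_a$ for all $a\ne b$. A zero energy assignment is one with $\sum_{i\in C}S_i=M_C$ for every column $C$. A global minimum is an assignment minimizing $H$. For an integer $k\ge1$, an assignment $A$ is a $k$-minimum if every assignment differing from $A$ in at least one and at most $k$ variables has a strictly larger value of $H$ than $A$. -}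

module Defs where

open import Data.Nat using (ℕ; zero; suc; _+_; _∸_)
open import Data.Nat as ℕ using ()
open import Relation.Binary.PropositionalEquality using (_≡_)
open import Data.Fin using (Fin)
open import Data.Vec using (Vec; []; _∷_; insertAt)
open import Data.List using (List; []; _∷_; map; concatMap; foldr; length; filterᵇ; allFin)
open import Data.Bool using (Bool; true; false; _xor_)
open import Data.Product using (_×_; _,_)
open import Data.Integer as ℤ using (ℤ; +_; -_)

Site : ℕ → ℕ → Set
Site f l = Vec (Fin l) f

allSites : (f l : ℕ) → List (Site f l)
allSites zero    l = [] ∷ []
allSites (suc f) l = concatMap (λ x → map (x ∷_) (allSites f l)) (allFin l)

Assignment : ℕ → ℕ → Set
Assignment f l = Site f l → Bool

spin : Bool → ℤ
spin true  = + 1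
spin false = - (+ 1)

-- Columns for f = suc n: a direction b ∈ Fin (suc n) together with the
-- values y_a for the n coordinates a ≠ b.  The site of the column with
-- b-th coordinate x is  insertAt y b x.
Column : ℕ → ℕ → Set
Column n l = Fin (suc n) × Vec (Fin l) n

allColumns : (n l : ℕ) → List (Column n l)
allColumns n l = concatMap (λ b → map (b ,_) (allSites n l)) (allFin (suc n))

sumℤ : List ℤ → ℤ
sumℤ = foldr ℤ._+_ (+ 0)

columnSum : {n l : ℕ} → Assignment (suc n) l → Column n l → ℤ
columnSum {n} {l} S (b , y) = sumℤ (map (λ x → spin (S (insertAt y b x))) (allFin l))

H : {n l : ℕ} → (Column n l → ℤ) → Assignment (suc n) l → ℤ
H {n} {l} M S =
  sumℤ (map (λ C → (columnSum S C ℤ.- M C) ℤ.* (columnSum S C ℤ.- M C)) (allColumns n l))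

ZeroEnergy : {n l : ℕ} → (Column n l → ℤ) → Assignment (suc n) l → Set
ZeroEnergy M S = ∀ C → columnSum S C ≡ M C

distance : {f l : ℕ} → Assignment f l → Assignment f l → ℕ
distance {f} {l} A B = length (filterᵇ (λ i → A i xor B i) (allSites f l))

GlobalMinimum : {n l : ℕ} → (Column n l → ℤ) → Assignment (suc n) l → Set
GlobalMinimum M A = ∀ B → H M A ℤ.≤ H M B

kMinimum : {n l : ℕ} → ℕ → (Column n l → ℤ) → Assignment (suc n) l → Set
kMinimum k M A = ∀ B → 1 ℕ.≤ distance A B → distance A B ℕ.≤ k → H M A ℤ.< H M B

-- A global minimum has energy 0 because some assignment does, so every competitor of
-- energy 0 has the same sum along every line as the minimum.  If two assignments with
-- equal line sums differ at a site, the line through it in the first direction contains a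
-- second differing site (otherwise the two line sums would differ by ±2), and the two hyperplane
-- slices through these sites again have equal line sums.  By induction on the dimension
-- they differ in at least 2^f sites, so a competitor at distance 1 … 2^f − 1 has positive
-- energy.
module Submission where

open import Defs
open import Data.Nat using (ℕ; suc; _^_; _∸_; _≤_)
open import Data.Nat.Divisibility using (_∣_)
open import Data.Integer using (ℤ)
open import Data.Product using (∃)

open import Data.Bool as Bool using (Bool; true; false; T; _xor_)
import Data.Bool.Properties as Bool
open import Data.Empty using (⊥-elim)
open import Data.Fin as Fin using (Fin)
open import Function using (_∘_)
open import Data.Fin.Properties using (¬∀⟶∃¬)
open import Data.Integer as ℤ using (0ℤ; +≤+)
import Data.Integer.Properties as ℤ
open import Data.List using (List; []; _∷_; _++_; map; concatMap; filterᵇ; length; allFin)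
open import Data.List.Membership.Propositional using (_∈_; lose)
open import Data.List.Membership.Propositional.Properties
  using (∈-allFin; ∈-map⁺; ∈-concatMap⁺)
open import Data.List.Properties using (filter-++; length-++; map-cong; map-cong-local)
open import Data.List.Relation.Unary.All as All using (All; []; _∷_)
import Data.List.Relation.Unary.All.Properties as All
open import Data.List.Relation.Unary.Any using (here; there)
open import Data.List.Relation.Unary.Unique.Propositional using (Unique; []; _∷_)
open import Data.List.Relation.Unary.Unique.Propositional.Properties using (allFin⁺)
open import Data.Nat as ℕ using (zero; _+_; z≤n; s≤s)
open import Data.Nat.ListAction using (sum)
import Data.Nat.Properties as ℕ
open import Data.Product using (_×_; _,_)
open import Data.Sum using (_⊎_; inj₁; inj₂; [_,_]′; reduce)
open import Data.Vec using (Vec; []; _∷_; insertAt; removeAt; _[_]≔_)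
open import Relation.Nullary using (¬_)
open import Relation.Nullary.Decidable using (_⊎-dec_)
open import Relation.Binary.PropositionalEquality

open import Algebra.Properties.AbelianGroup ℤ.+-0-abelianGroup using (∙-cancelˡ; ∙-cancelʳ)

private
  variable
    X Y : Set

∈-allSites : ∀ {f l} (i : Site f l) → i ∈ allSites f l
∈-allSites []      = here refl
∈-allSites {suc f} {l} (x ∷ i) =
  ∈-concatMap⁺ (λ y → map (y ∷_) (allSites f l)) (lose (∈-allFin x) (∈-map⁺ (x ∷_) (∈-allSites i)))

∈-allColumns : ∀ {n l} (C : Column n l) → C ∈ allColumns n l
∈-allColumns {n} {l} (b , y) =
  ∈-concatMap⁺ (λ c → map (c ,_) (allSites n l)) (lose (∈-allFin b) (∈-map⁺ (b ,_) (∈-allSites y)))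

length-filterᵇ-++ : ∀ (p : X → Bool) xs ys →
  length (filterᵇ p (xs ++ ys)) ≡ length (filterᵇ p xs) + length (filterᵇ p ys)
length-filterᵇ-++ p xs ys =
  trans (cong length (filter-++ (Bool.T? ∘ p) xs ys)) (length-++ (filterᵇ p xs))

length-filterᵇ-map : ∀ (p : Y → Bool) (g : X → Y) xs →
  length (filterᵇ p (map g xs)) ≡ length (filterᵇ (λ x → p (g x)) xs)
length-filterᵇ-map p g []       = refl
length-filterᵇ-map p g (x ∷ xs) with p (g x)
... | true  = cong suc (length-filterᵇ-map p g xs)
... | false = length-filterᵇ-map p g xs

length-filterᵇ-concatMap : ∀ (p : Y → Bool) (g : X → List Y) xs →
  length (filterᵇ p (concatMap g xs)) ≡ sum (map (λ x → length (filterᵇ p (g x))) xs)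
length-filterᵇ-concatMap p g []       = refl
length-filterᵇ-concatMap p g (x ∷ xs) =
  trans (length-filterᵇ-++ p (g x) (concatMap g xs))
        (cong (length (filterᵇ p (g x)) +_) (length-filterᵇ-concatMap p g xs))

length-filterᵇ-pos : ∀ (p : X → Bool) xs → 1 ≤ length (filterᵇ p xs) → ∃ (T ∘ p)
length-filterᵇ-pos p (x ∷ xs) 1≤len with p x in px
... | true  = x , subst T (sym px) _
... | false = length-filterᵇ-pos p xs 1≤len

≤-sum-map : ∀ (h : X → ℕ) {x xs} → x ∈ xs → h x ≤ sum (map h xs)
≤-sum-map h {xs = y ∷ ys} (here refl) = ℕ.m≤m+n (h y) _
≤-sum-map h {xs = y ∷ ys} (there x∈) = ℕ.≤-trans (≤-sum-map h x∈) (ℕ.m≤n+m _ (h y))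

+-≤-sum-map : ∀ (h : X → ℕ) {x y xs} → x ∈ xs → y ∈ xs → x ≢ y → h x + h y ≤ sum (map h xs)
+-≤-sum-map h (here refl) (here refl) x≢y = ⊥-elim (x≢y refl)
+-≤-sum-map h (here refl) (there y∈)  _   = ℕ.+-monoʳ-≤ _ (≤-sum-map h y∈)
+-≤-sum-map h {x} {y} {_ ∷ ys} (there x∈) (here refl) _ =
  subst (_≤ h y + sum (map h ys)) (ℕ.+-comm (h y) (h x)) (ℕ.+-monoʳ-≤ (h y) (≤-sum-map h x∈))
+-≤-sum-map h {xs = z ∷ _} (there x∈) (there y∈) x≢y =
  ℕ.≤-trans (+-≤-sum-map h x∈ y∈ x≢y) (ℕ.m≤n+m _ (h z))

sumℤ-nonNeg : ∀ {xs} → All (0ℤ ℤ.≤_) xs → 0ℤ ℤ.≤ sumℤ xs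
sumℤ-nonNeg []           = +≤+ z≤n
sumℤ-nonNeg (0≤x ∷ 0≤xs) = ℤ.+-mono-≤ 0≤x (sumℤ-nonNeg 0≤xs)

nonNeg-+≡0 : ∀ {a b} → 0ℤ ℤ.≤ a → 0ℤ ℤ.≤ b → a ℤ.+ b ≡ 0ℤ → a ≡ 0ℤ × b ≡ 0ℤ
nonNeg-+≡0 {ℤ.+ m} {ℤ.+ k} _ _ eq =
  cong ℤ.+_ (ℕ.m+n≡0⇒m≡0 m m+k≡0) , cong ℤ.+_ (ℕ.m+n≡0⇒n≡0 m m+k≡0)
  where m+k≡0 = ℤ.+-injective eq

sumℤ≡0⇒zeros : ∀ {xs} → All (0ℤ ℤ.≤_) xs → sumℤ xs ≡ 0ℤ → All (_≡ 0ℤ) xs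
sumℤ≡0⇒zeros []           _  = []
sumℤ≡0⇒zeros (0≤x ∷ 0≤xs) eq =
  let x≡0 , rest≡0 = nonNeg-+≡0 0≤x (sumℤ-nonNeg 0≤xs) eq
  in x≡0 ∷ sumℤ≡0⇒zeros 0≤xs rest≡0

zeros⇒sumℤ≡0 : ∀ {xs} → All (_≡ 0ℤ) xs → sumℤ xs ≡ 0ℤ
zeros⇒sumℤ≡0 []             = refl
zeros⇒sumℤ≡0 (refl ∷ zeros) = trans (ℤ.+-identityˡ _) (zeros⇒sumℤ≡0 zeros)

square-nonNeg : ∀ x → 0ℤ ℤ.≤ x ℤ.* x
square-nonNeg (ℤ.+ zero)   = +≤+ z≤n
square-nonNeg ℤ.+[1+ n ]  = +≤+ z≤n
square-nonNeg ℤ.-[1+ n ]  = +≤+ z≤n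

square≡0⇒≡0 : ∀ x → x ℤ.* x ≡ 0ℤ → x ≡ 0ℤ
square≡0⇒≡0 x eq = reduce (ℤ.i*j≡0⇒i≡0∨j≡0 x eq)

squares-nonNeg : ∀ (g : X → ℤ) xs → All (0ℤ ℤ.≤_) (map (λ x → g x ℤ.* g x) xs)
squares-nonNeg g xs = All.map⁺ (All.universal (λ x → square-nonNeg (g x)) xs)

residual : ∀ {n l} → (Column n l → ℤ) → Assignment (suc n) l → Column n l → ℤ
residual M S C = columnSum S C ℤ.- M C

H-nonNeg : ∀ {n l} (M : Column n l → ℤ) S → 0ℤ ℤ.≤ H M S
H-nonNeg {n} {l} M S = sumℤ-nonNeg (squares-nonNeg (residual M S) (allColumns n l))

H≡0⇒zeroEnergy : ∀ {n l} (M : Column n l → ℤ) S → H M S ≡ 0ℤ → ZeroEnergy M S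
H≡0⇒zeroEnergy {n} {l} M S H≡0 C =
  ℤ.i-j≡0⇒i≡j _ _ (square≡0⇒≡0 _ (All.lookup squares≡0 (∈-allColumns C)))
  where squares≡0 = All.map⁻ (sumℤ≡0⇒zeros (squares-nonNeg (residual M S) (allColumns n l)) H≡0)

zeroEnergy⇒H≡0 : ∀ {n l} (M : Column n l → ℤ) S → ZeroEnergy M S → H M S ≡ 0ℤ
zeroEnergy⇒H≡0 {n} {l} M S S-zero =
  zeros⇒sumℤ≡0 (All.map⁺ (All.universal square≡0 (allColumns n l)))
  where
  square≡0 : ∀ C → residual M S C ℤ.* residual M S C ≡ 0ℤ
  square≡0 C = cong (λ r → r ℤ.* r) (ℤ.i≡j⇒i-j≡0 (S-zero C))

spinSum : ∀ {l} → (Fin l → Bool) → ℤ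
spinSum {l} a = sumℤ (map (spin ∘ a) (allFin l))

lineSum : ∀ {f l} → Assignment f l → Site f l → Fin f → ℤ
lineSum S i b = spinSum (λ x → S (i [ b ]≔ x))

-- Lines are named by any of their sites i together with their direction b.
Balanced : ∀ {f l} → Assignment f l → Assignment f l → Set
Balanced A B = ∀ i b → lineSum A i b ≡ lineSum B i b

insertAt-removeAt-≔ : ∀ {n} (xs : Vec X (suc n)) i v → insertAt (removeAt xs i) i v ≡ xs [ i ]≔ v
insertAt-removeAt-≔ (x ∷ xs)         Fin.zero    v = refl
insertAt-removeAt-≔ (x ∷ xs@(_ ∷ _)) (Fin.suc i) v = cong (x ∷_) (insertAt-removeAt-≔ xs i v)

lineSum≡columnSum : ∀ {n l} (S : Assignment (suc n) l) i b →
                    lineSum S i b ≡ columnSum S (b , removeAt i b)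
lineSum≡columnSum {l = l} S i b =
  cong sumℤ (map-cong (λ x → cong (spin ∘ S) (sym (insertAt-removeAt-≔ i b x))) (allFin l))

zeroEnergy⇒balanced : ∀ {n l} {M : Column n l → ℤ} (A B : Assignment (suc n) l) →
                      ZeroEnergy M A → ZeroEnergy M B → Balanced A B
zeroEnergy⇒balanced A B A-zero B-zero i b = begin
  lineSum A i b                  ≡⟨ lineSum≡columnSum A i b ⟩
  columnSum A (b , removeAt i b) ≡⟨ A-zero _ ⟩
  _                              ≡⟨ B-zero _ ⟨
  columnSum B (b , removeAt i b) ≡⟨ lineSum≡columnSum B i b ⟨
  lineSum B i b                  ∎
  where open ≡-Reasoning

sumℤ-map-≡⇒≡-at : ∀ {f g : X → ℤ} {c xs} → Unique xs → c ∈ xs → (∀ x → x ≢ c → f x ≡ g x) →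
                  sumℤ (map f xs) ≡ sumℤ (map g xs) → f c ≡ g c
sumℤ-map-≡⇒≡-at {f = f} {g} {c} {_ ∷ xs} (c∉xs ∷ _) (here refl) agree eq =
  ∙-cancelʳ (sumℤ (map g xs)) (f c) (g c) (subst (λ ys → f c ℤ.+ sumℤ ys ≡ _) rest-equal eq)
  where rest-equal = map-cong-local (All.map (λ c≢x → agree _ (c≢x ∘ sym)) c∉xs)
sumℤ-map-≡⇒≡-at {f = f} {g} {xs = x ∷ _} (x∉xs ∷ unique) (there c∈) agree eq =
  sumℤ-map-≡⇒≡-at unique c∈ agree (∙-cancelˡ (f x) _ _ (trans eq (cong (ℤ._+ _) (sym fx≡gx))))
  where fx≡gx = agree x (All.lookup x∉xs c∈)

spin-injective : ∀ {a b} → spin a ≡ spin b → a ≡ b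
spin-injective {true}  {true}  _ = refl
spin-injective {false} {false} _ = refl

spinSum-≡⇒differ-elsewhere : ∀ {l} {a b : Fin l → Bool} {c} → spinSum a ≡ spinSum b → a c ≢ b c →
                             ∃ λ x → x ≢ c × a x ≢ b x
spinSum-≡⇒differ-elsewhere {l} {a} {b} {c} eq ac≢bc =
  let x , ¬x≡c⊎ax≡bx = ¬∀⟶∃¬ l _ (λ x → (x Fin.≟ c) ⊎-dec (a x Bool.≟ b x)) ¬agree-off-c
  in x , ¬x≡c⊎ax≡bx ∘ inj₁ , ¬x≡c⊎ax≡bx ∘ inj₂
  where
  ¬agree-off-c : ¬ (∀ x → x ≡ c ⊎ a x ≡ b x)
  ¬agree-off-c agree = ac≢bc (spin-injective (sumℤ-map-≡⇒≡-at (allFin⁺ l) (∈-allFin c) agree-spin eq))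
    where
    agree-spin : ∀ x → x ≢ c → spin (a x) ≡ spin (b x)
    agree-spin x x≢c = [ ⊥-elim ∘ x≢c , cong spin ]′ (agree x)

slice : ∀ {f l} → Assignment (suc f) l → Fin l → Assignment f l
slice S x i = S (x ∷ i)

balanced-slice : ∀ {f l} (A B : Assignment (suc f) l) → Balanced A B →
                 ∀ x → Balanced (slice A x) (slice B x)
balanced-slice A B bal x i b = bal (x ∷ i) (Fin.suc b)

distance-slices : ∀ {f l} (A B : Assignment (suc f) l) →
                  distance A B ≡ sum (map (λ x → distance (slice A x) (slice B x)) (allFin l))
distance-slices {f} {l} A B =
  trans (length-filterᵇ-concatMap differ (λ x → map (x ∷_) (allSites f l)) (allFin l))
        (cong sum (map-cong (λ x → length-filterᵇ-map differ (x ∷_) (allSites f l)) (allFin l)))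
  where differ = λ i → A i xor B i

T-xor⇒≢ : ∀ {a b} → T (a xor b) → a ≢ b
T-xor⇒≢ {true}  {true}  ()
T-xor⇒≢ {false} {false} ()

distance-pos⇒differ : ∀ {f l} (A B : Assignment f l) → 1 ≤ distance A B → ∃ λ i → A i ≢ B i
distance-pos⇒differ {f} {l} A B 1≤d =
  let i , differ = length-filterᵇ-pos (λ i → A i xor B i) (allSites f l) 1≤d in i , T-xor⇒≢ differ

balanced⇒2^f≤distance : ∀ {f l} (A B : Assignment f l) → Balanced A B →
                        ∀ i → A i ≢ B i → 2 ^ f ≤ distance A B
balanced⇒2^f≤distance A B _ [] Ai≢Bi with A [] | B []
... | true  | true  = ⊥-elim (Ai≢Bi refl)
... | true  | false = s≤s z≤n
... | false | true  = s≤s z≤n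
... | false | false = ⊥-elim (Ai≢Bi refl)
balanced⇒2^f≤distance {suc f} {l} A B bal (c ∷ r) Ac≢Bc =
  let x , x≢c , Ax≢Bx = spinSum-≡⇒differ-elsewhere {a = λ x → A (x ∷ r)} {b = λ x → B (x ∷ r)}
                                                    (bal (c ∷ r) Fin.zero) Ac≢Bc
  in begin
    2 ^ suc f                          ≡⟨ cong (2 ^ f +_) (ℕ.+-identityʳ (2 ^ f)) ⟩
    2 ^ f + 2 ^ f                      ≤⟨ ℕ.+-mono-≤ (slice-bound c Ac≢Bc) (slice-bound x Ax≢Bx) ⟩
    sliceDistance c + sliceDistance x  ≤⟨ +-≤-sum-map sliceDistance (∈-allFin c) (∈-allFin x) (x≢c ∘ sym) ⟩
    sum (map sliceDistance (allFin l)) ≡⟨ distance-slices A B ⟨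
    distance A B                       ∎
  where
  open ℕ.≤-Reasoning
  sliceDistance : Fin l → ℕ
  sliceDistance x = distance (slice A x) (slice B x)
  slice-bound : ∀ x → A (x ∷ r) ≢ B (x ∷ r) → 2 ^ f ≤ sliceDistance x
  slice-bound x = balanced⇒2^f≤distance (slice A x) (slice B x) (balanced-slice A B bal x) r

lemma4 : (n l : ℕ) → 1 ≤ l → 2 ∣ l → (M : Column n l → ℤ) → ∃ (λ Z → ZeroEnergy M Z) → (A : Assignment (suc n) l) → GlobalMinimum M A → kMinimum (2 ^ suc n ∸ 1) M A
lemma4 n l _ _ M (Z , Z-zero) A A-min B 1≤d d≤k = begin-strict
  H M A ≡⟨ H-A≡0 ⟩
  0ℤ    <⟨ ℤ.≤∧≢⇒< (H-nonNeg M B) (H-B≢0 ∘ sym) ⟩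
  H M B ∎
  where
  open ℤ.≤-Reasoning
  H-A≡0 : H M A ≡ 0ℤ
  H-A≡0 = ℤ.≤-antisym (subst (H M A ℤ.≤_) (zeroEnergy⇒H≡0 M Z Z-zero) (A-min Z)) (H-nonNeg M A)
  ≰-pred : ∀ {k d} → 0 ℕ.< k → k ≤ d → ¬ d ≤ k ∸ 1
  ≰-pred {suc k} _ k≤d d≤k = ℕ.1+n≰n (ℕ.≤-trans k≤d d≤k)
  H-B≢0 : H M B ≢ 0ℤ
  H-B≢0 H-B≡0 =
    let i , Ai≢Bi = distance-pos⇒differ A B 1≤d
        balanced  = zeroEnergy⇒balanced A B (H≡0⇒zeroEnergy M A H-A≡0) (H≡0⇒zeroEnergy M B H-B≡0)
    in ≰-pred (ℕ.m^n>0 2 (suc n)) (balanced⇒2^f≤distance A B balanced i Ai≢Bi) d≤k
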